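{- The subset \[ S=\Big\{\Big(g(z^2),\ z,\ \tfrac{f(z^2)}{z}\Big) : g\in\mathcal{F}_0,\ f\in\mathcal{F}_1\Big\} \] of the Double Riordan group is a subgroup of the Double Riordan group.
   Context: Work with formal power series in $z$ over $\mathbb{C}$. Let $\mathcal{F}_0$ be the set of formal power series with nonzero constant term, and $\mathcal{F}_1$ the set of formal power series with zero constant term and nonzero coefficient of $z$. A Double Riordan array $(g,f_1,f_2)$ is given by an even series $g\in\mathcal{F}_0$ and odd series $f_1,f_2\in\mathcal{F}_1$; it is the infinite lower-triangular matrix whose columns have generating functions $g,\ gf_1,\ gf_1f_2,\ gf_1(f_1f_2),\ g(f_1f_2)^2,\dots$ (multiplying alternately by $f_1$ and $f_2$). The Double Riordan group is the set of these arrays under matrix multiplication, which is given by $(g,f_1,f_2)*(G,F_1,F_2)=\big(g\,G(h),\ \tfrac{f_1}{h}F_1(h),\ \tfrac{f_2}{h}F_2(h)\big)$ where $h=\sqrt{f_1f_2}\in\mathcal{F}_1$ (the result does not depend on the choice of square root). Its identity is $(1,z,z)$. For $f\in\mathcal{F}_1$, $f(z^2)/z$ is an odd series in $\mathcal{F}_1$ and $g(z^2)$ is an even series in $\mathcal{F}_0$ for $g\in\mathcal{F}_0$. -}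

module Defs where

open import Level using (_⊔_)
open import Data.Nat using (ℕ; zero; suc; _∸_) renaming (_+_ to _ℕ+_)
open import Data.Product using (Σ; _×_; ∃-syntax)
open import Relation.Nullary using (¬_)
open import Algebra.Bundles using (CommutativeRing)

IsField : ∀ {c ℓ} → CommutativeRing c ℓ → Set (c ⊔ ℓ)
IsField R = (¬ (1# ≈ 0#)) × (∀ x → ¬ (x ≈ 0#) → Σ Carrier λ y → x * y ≈ 1#)
  where open CommutativeRing R

module DR {c ℓ} (R : CommutativeRing c ℓ) where
  open CommutativeRing R using (Carrier; _≈_; _+_; _*_; 0#; 1#)

  Series : Set c
  Series = ℕ → Carrier

  sumTo : (ℕ → Carrier) → ℕ → Carrier
  sumTo a zero    = a zero
  sumTo a (suc n) = sumTo a n + a (suc n)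

  _⋆_ : Series → Series → Series
  (a ⋆ b) n = sumTo (λ j → a j * b (n ∸ j)) n

  zS : Series
  zS zero          = 0#
  zS (suc zero)    = 1#
  zS (suc (suc n)) = 0#

  sub-z² : Series → Series
  sub-z² g zero          = g zero
  sub-z² g (suc zero)    = 0#
  sub-z² g (suc (suc n)) = sub-z² (λ m → g (suc m)) n

  -- s / z  (for s with zero constant term)
  div-z : Series → Series
  div-z s n = s (suc n)

  InF₀ : Series → Set ℓ
  InF₀ g = ¬ (g 0 ≈ 0#)

  InF₁ : Series → Set ℓ
  InF₁ f = (f 0 ≈ 0#) × ¬ (f 1 ≈ 0#)

  IsEven : Series → Set ℓ
  IsEven g = ∀ n → g (suc (n ℕ+ n)) ≈ 0#

  IsOdd : Series → Set ℓ
  IsOdd f = ∀ n → f (n ℕ+ n) ≈ 0#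

  -- infinite matrices (entry n k = row n, column k)
  Matrix : Set c
  Matrix = ℕ → ℕ → Carrier

  _≋_ : Matrix → Matrix → Set ℓ
  A ≋ B = ∀ n k → A n k ≈ B n k

  -- product of (lower-triangular) infinite matrices:
  -- (A B)(n,k) = Σ_{j=0}^{n} A(n,j) B(j,k)
  _⊗_ : Matrix → Matrix → Matrix
  (A ⊗ B) n k = sumTo (λ j → A n j * B j k) n

  Id : Matrix
  Id zero    zero    = 1#
  Id zero    (suc k) = 0#
  Id (suc n) zero    = 0#
  Id (suc n) (suc k) = Id n k

  column : Series → Series → Series → ℕ → Series
  column g f₁ f₂ zero          = g
  column g f₁ f₂ (suc zero)    = g ⋆ f₁
  column g f₁ f₂ (suc (suc k)) = (column g f₁ f₂ k ⋆ f₁) ⋆ f₂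

  DRA : Series → Series → Series → Matrix
  DRA g f₁ f₂ n k = column g f₁ f₂ k n

  InDR : Matrix → Set (c ⊔ ℓ)
  InDR M = ∃[ g ] ∃[ f₁ ] ∃[ f₂ ]
    (IsEven g × InF₀ g × IsOdd f₁ × InF₁ f₁ × IsOdd f₂ × InF₁ f₂ × (M ≋ DRA g f₁ f₂))

  InS : Matrix → Set (c ⊔ ℓ)
  InS M = ∃[ g ] ∃[ f ] (InF₀ g × InF₁ f × (M ≋ DRA (sub-z² g) zS (div-z (sub-z² f))))

  IsSubgroupDR : (Matrix → Set (c ⊔ ℓ)) → Set (c ⊔ ℓ)
  IsSubgroupDR P =
    (∀ M → P M → InDR M)
    × P Id
    × (∀ A B → P A → P B → P (A ⊗ B))
    × (∀ A → P A → ∃[ B ] (P B × ((A ⊗ B) ≋ Id) × ((B ⊗ A) ≋ Id)))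

-- Column 2k of (g(z²), z, f(z²)/z) is g(z²) f(z²)ᵏ and column 2k + 1 is z g(z²) f(z²)ᵏ,
-- so the array is the ordinary Riordan array (g, f) with every entry r replaced by the
-- 2 × 2 block diag(r, r). This doubling is injective and commutes with matrix products,
-- so S is the image of the Riordan group: the product, identity and inverses of S come
-- from (g₁, f₁)(g₂, f₂) = (g₁ g₂(f₁), f₂(f₁)), from (1, z), and from reciprocals and
-- compositional inverses, which exist over a field because they are fixpoints of
-- contractive maps on power series.

module Submission where

open import Defs
open import Algebra.Bundles using (CommutativeRing; CommutativeSemiring)
open import Data.Nat using (ℕ; zero; suc; _∸_; _≤_; _<_; z≤n; s≤s) renaming (_+_ to _ℕ+_)
open import Data.Nat.Properties
  using (m∸n≤m; ≤-trans; <-≤-trans; ≤-<-trans; ≤-refl; n<1+n; n≤1+n; m≤n⇒m≤1+n; +-suc; m∸[m∸n]≡n; +-∸-assoc; m+[n∸m]≡n; n∸n≡0)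
open import Data.Product using (Σ; _×_; _,_; proj₁; proj₂; ∃-syntax)
open import Level using (_⊔_)
open import Relation.Nullary using (¬_)
open import Relation.Binary.Bundles using (Setoid)
open import Relation.Binary.PropositionalEquality as P using (_≡_)
import Relation.Binary.Reasoning.Setoid as SetoidR

module PowerSeries {c ℓ} (K : CommutativeRing c ℓ) where
  open CommutativeRing K hiding (zero)
  open DR K
  open SetoidR setoid
  open import Algebra.Properties.CommutativeSemigroup +-commutativeSemigroup
    using () renaming (interchange to +-interchange)
  open import Algebra.Properties.CommutativeSemigroup *-commutativeSemigroup
    using (x∙yz≈y∙xz)
  open import Algebra.Properties.Ring ring using (-‿distribʳ-*)

  sumTo-cong : ∀ {f g : ℕ → Carrier} n → (∀ j → j ≤ n → f j ≈ g j) → sumTo f n ≈ sumTo g n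
  sumTo-cong zero    f≈g = f≈g 0 z≤n
  sumTo-cong (suc n) f≈g = +-cong (sumTo-cong n (λ j j≤n → f≈g j (m≤n⇒m≤1+n j≤n))) (f≈g (suc n) ≤-refl)

  sumTo-unfold : ∀ f n → sumTo f (suc n) ≈ f 0 + sumTo (λ j → f (suc j)) n
  sumTo-unfold f zero    = refl
  sumTo-unfold f (suc n) = trans (+-cong (sumTo-unfold f n) refl) (+-assoc _ _ _)

  sumTo-+ : ∀ f g n → sumTo (λ j → f j + g j) n ≈ sumTo f n + sumTo g n
  sumTo-+ f g zero    = refl
  sumTo-+ f g (suc n) = trans (+-cong (sumTo-+ f g n) refl) (+-interchange _ _ _ _)

  sumTo-*ˡ : ∀ s f n → sumTo (λ j → s * f j) n ≈ s * sumTo f n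
  sumTo-*ˡ s f zero    = refl
  sumTo-*ˡ s f (suc n) = trans (+-cong (sumTo-*ˡ s f n) refl) (sym (distribˡ _ _ _))

  sumTo-zero : ∀ {f} n → (∀ j → j ≤ n → f j ≈ 0#) → sumTo f n ≈ 0#
  sumTo-zero n f≈0 = trans (sumTo-cong n f≈0) (zeros n)
    where
    zeros : ∀ n → sumTo (λ _ → 0#) n ≈ 0#
    zeros zero    = refl
    zeros (suc n) = trans (+-cong (zeros n) refl) (+-identityʳ 0#)

  sumTo-reverse : ∀ f n → sumTo f n ≈ sumTo (λ j → f (n ∸ j)) n
  sumTo-reverse f zero    = refl
  sumTo-reverse f (suc n) = begin
    sumTo f (suc n)                          ≈⟨ sumTo-unfold f n ⟩
    f 0 + sumTo (λ j → f (suc j)) n           ≈⟨ +-cong refl (sumTo-reverse (λ j → f (suc j)) n) ⟩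
    f 0 + sumTo (λ j → f (suc (n ∸ j))) n     ≈⟨ +-comm _ _ ⟩
    sumTo (λ j → f (suc (n ∸ j))) n + f 0     ≈⟨ +-cong (sumTo-cong n (λ j j≤n → reflexive (P.cong f (P.sym (+-∸-assoc 1 j≤n)))))
                                                         (reflexive (P.cong f (P.sym (n∸n≡0 n)))) ⟩
    sumTo (λ j → f (suc n ∸ j)) (suc n)      ∎

  -- Formal power series

  infix 4 _≐_ _≃[_]_

  _≐_ : Series → Series → Set ℓ
  a ≐ b = ∀ n → a n ≈ b n

  _≃[_]_ : Series → ℕ → Series → Set ℓ
  a ≃[ n ] b = ∀ m → m < n → a m ≈ b m

  ≐-refl : ∀ {a} → a ≐ a
  ≐-refl _ = refl

  ≐-sym : ∀ {a b} → a ≐ b → b ≐ a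
  ≐-sym a≐b n = sym (a≐b n)

  ≐-trans : ∀ {a b d} → a ≐ b → b ≐ d → a ≐ d
  ≐-trans a≐b b≐d n = trans (a≐b n) (b≐d n)

  ≃-refl : ∀ {a n} → a ≃[ n ] a
  ≃-refl _ _ = refl

  ≐⇒≃ : ∀ {a b n} → a ≐ b → a ≃[ n ] b
  ≐⇒≃ a≐b m _ = a≐b m

  𝟘 : Series
  𝟘 _ = 0#

  one : Series
  one zero    = 1#
  one (suc n) = 0#

  _⊕_ : Series → Series → Series
  (a ⊕ b) n = a n + b n

  _·_ : Carrier → Series → Series
  (s · a) n = s * a n

  const : Carrier → Series
  const s = s · one

  ⊕-cong : ∀ {a a′ b b′} → a ≐ a′ → b ≐ b′ → a ⊕ b ≐ a′ ⊕ b′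
  ⊕-cong a≐a′ b≐b′ n = +-cong (a≐a′ n) (b≐b′ n)

  ⋆-unfold : ∀ a b n → (a ⋆ b) (suc n) ≈ a 0 * b (suc n) + (div-z a ⋆ b) n
  ⋆-unfold a b n = sumTo-unfold _ n

  ⋆-cong≃ : ∀ {a a′ b b′} n → a ≃[ n ] a′ → b ≃[ n ] b′ → a ⋆ b ≃[ n ] a′ ⋆ b′
  ⋆-cong≃ n a≃a′ b≃b′ m m<n = sumTo-cong m (λ j j≤m →
    *-cong (a≃a′ j (≤-<-trans j≤m m<n)) (b≃b′ _ (≤-<-trans (m∸n≤m m j) m<n)))

  ⋆-cong : ∀ {a a′ b b′} → a ≐ a′ → b ≐ b′ → a ⋆ b ≐ a′ ⋆ b′
  ⋆-cong a≐a′ b≐b′ n = sumTo-cong n (λ j _ → *-cong (a≐a′ j) (b≐b′ _))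

  ⋆-congˡ : ∀ {a a′} b → a ≐ a′ → a ⋆ b ≐ a′ ⋆ b
  ⋆-congˡ b a≐a′ = ⋆-cong a≐a′ (≐-refl {b})

  ⋆-congʳ : ∀ a {b b′} → b ≐ b′ → a ⋆ b ≐ a ⋆ b′
  ⋆-congʳ a = ⋆-cong (≐-refl {a})

  ⋆-comm : ∀ a b → a ⋆ b ≐ b ⋆ a
  ⋆-comm a b n = trans (sumTo-reverse _ n)
    (sumTo-cong n (λ j j≤n → trans (*-cong refl (reflexive (P.cong b (m∸[m∸n]≡n j≤n)))) (*-comm _ _)))

  ⋆-distribʳ : ∀ a b c → (a ⊕ b) ⋆ c ≐ (a ⋆ c) ⊕ (b ⋆ c)
  ⋆-distribʳ a b c n = trans (sumTo-cong n (λ j _ → distribʳ _ _ _)) (sumTo-+ _ _ n)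

  ·-⋆ : ∀ s a b → (s · a) ⋆ b ≐ s · (a ⋆ b)
  ·-⋆ s a b n = trans (sumTo-cong n (λ j _ → *-assoc _ _ _)) (sumTo-*ˡ s _ n)

  𝟘-⋆ : ∀ a → 𝟘 ⋆ a ≐ 𝟘
  𝟘-⋆ a n = sumTo-zero n (λ j _ → zeroˡ _)

  one-⋆ : ∀ a → one ⋆ a ≐ a
  one-⋆ a zero    = *-identityˡ _
  one-⋆ a (suc n) = trans (⋆-unfold one a n) (trans (+-cong (*-identityˡ _) (𝟘-⋆ a n)) (+-identityʳ _))

  div-z-⋆ : ∀ a b → div-z (a ⋆ b) ≐ (a 0 · div-z b) ⊕ (div-z a ⋆ b)
  div-z-⋆ a b = ⋆-unfold a b

  ⋆-assoc : ∀ a b c → (a ⋆ b) ⋆ c ≐ a ⋆ (b ⋆ c)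
  ⋆-assoc a b c zero    = *-assoc _ _ _
  ⋆-assoc a b c (suc n) = begin
    ((a ⋆ b) ⋆ c) (suc n)
      ≈⟨ ⋆-unfold (a ⋆ b) c n ⟩
    (a 0 * b 0) * c (suc n) + (div-z (a ⋆ b) ⋆ c) n
      ≈⟨ +-cong refl (trans (⋆-congˡ c (div-z-⋆ a b) n) (⋆-distribʳ _ _ c n)) ⟩
    (a 0 * b 0) * c (suc n) + (((a 0 · div-z b) ⋆ c) n + ((div-z a ⋆ b) ⋆ c) n)
      ≈⟨ +-cong refl (+-cong (·-⋆ (a 0) (div-z b) c n) (⋆-assoc (div-z a) b c n)) ⟩
    (a 0 * b 0) * c (suc n) + (a 0 * (div-z b ⋆ c) n + (div-z a ⋆ (b ⋆ c)) n)
      ≈⟨ regroup _ _ _ _ _ ⟩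
    a 0 * (b 0 * c (suc n) + (div-z b ⋆ c) n) + (div-z a ⋆ (b ⋆ c)) n
      ≈⟨ sym (trans (⋆-unfold a (b ⋆ c) n) (+-cong (*-cong refl (⋆-unfold b c n)) refl)) ⟩
    (a ⋆ (b ⋆ c)) (suc n) ∎
    where
    open import Algebra.Solver.Ring.NaturalCoefficients.Default commutativeSemiring
    regroup : ∀ p q x y z → (p * q) * x + (p * y + z) ≈ p * (q * x + y) + z
    regroup = solve 5 (λ p q x y z → (p :* q) :* x :+ (p :* y :+ z) := p :* (q :* x :+ y) :+ z) refl

  seriesSemiring : CommutativeSemiring c ℓ
  seriesSemiring = record
    { Carrier = Series ; _≈_ = _≐_ ; _+_ = _⊕_ ; _*_ = _⋆_ ; 0# = 𝟘 ; 1# = one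
    ; isCommutativeSemiring = record
      { isSemiring = record
        { isSemiringWithoutAnnihilatingZero = record
          { +-isCommutativeMonoid = record
            { isMonoid = record
              { isSemigroup = record
                { isMagma = record
                  { isEquivalence = record { refl = ≐-refl ; sym = ≐-sym ; trans = ≐-trans }
                  ; ∙-cong = ⊕-cong }
                ; assoc = λ a b d n → +-assoc _ _ _ }
              ; identity = (λ a n → +-identityˡ _) , (λ a n → +-identityʳ _) }
            ; comm = λ a b n → +-comm _ _ }
          ; *-cong = ⋆-cong
          ; *-assoc = ⋆-assoc
          ; *-identity = one-⋆ , λ a → ≐-trans (⋆-comm a one) (one-⋆ a)
          ; distrib = (λ a b d → ≐-trans (⋆-comm a (b ⊕ d))
                                  (≐-trans (⋆-distribʳ b d a) (⊕-cong (⋆-comm b a) (⋆-comm d a))))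
                    , (λ a b d → ⋆-distribʳ b d a) }
        ; zero = 𝟘-⋆ , λ a → ≐-trans (⋆-comm a 𝟘) (𝟘-⋆ a) }
      ; *-comm = ⋆-comm } }

  open CommutativeSemiring seriesSemiring public using ()
    renaming (*-identityʳ to ⋆-one; zeroʳ to ⋆-𝟘; *-commutativeSemigroup to ⋆-commutativeSemigroup)
  open import Algebra.Properties.CommutativeSemigroup ⋆-commutativeSemigroup
    using () renaming (xy∙z≈xz∙y to ⋆-swapʳ)

  shift : Series → Series
  shift a zero    = 0#
  shift a (suc n) = a n

  div-z-zS : div-z zS ≐ one
  div-z-zS zero    = refl
  div-z-zS (suc n) = refl

  zS-⋆ : ∀ a → zS ⋆ a ≐ shift a
  zS-⋆ a zero    = zeroˡ _
  zS-⋆ a (suc n) = begin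
    (zS ⋆ a) (suc n)                    ≈⟨ ⋆-unfold zS a n ⟩
    0# * a (suc n) + (div-z zS ⋆ a) n    ≈⟨ +-cong (zeroˡ _) (trans (⋆-congˡ a div-z-zS n) (one-⋆ a n)) ⟩
    0# + a n                            ≈⟨ +-identityˡ _ ⟩
    a n                                 ∎

  const-⋆ : ∀ s a → const s ⋆ a ≐ s · a
  const-⋆ s a n = trans (·-⋆ s one a n) (*-cong refl (one-⋆ a n))

  record ConstantFree (f : Series) : Set ℓ where
    constructor constantFree
    field constant≈0 : f 0 ≈ 0#

  constantFree-* : ∀ {f} → ConstantFree f → ∀ x → f 0 * x ≈ 0#
  constantFree-* (constantFree f₀≈0) x = trans (*-cong f₀≈0 refl) (zeroˡ x)

  constantFree-zS : ConstantFree zS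
  constantFree-zS = constantFree refl

  constantFree-⋆ʳ : ∀ {f} → ConstantFree f → ∀ a → ConstantFree (a ⋆ f)
  constantFree-⋆ʳ (constantFree f₀≈0) a = constantFree (trans (*-cong refl f₀≈0) (zeroʳ _))

  zS-⋆-div-z : ∀ {f} → ConstantFree f → zS ⋆ div-z f ≐ f
  zS-⋆-div-z {f} (constantFree f₀≈0) zero    = trans (zS-⋆ (div-z f) zero) (sym f₀≈0)
  zS-⋆-div-z {f} _                   (suc n) = zS-⋆ (div-z f) (suc n)

  div-z-⋆-constantFree : ∀ {f} → ConstantFree f → ∀ a → div-z (a ⋆ f) ≐ div-z f ⋆ a
  div-z-⋆-constantFree {f} f₀ a n = begin
    (a ⋆ f) (suc n)                    ≈⟨ ⋆-comm a f (suc n) ⟩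
    (f ⋆ a) (suc n)                    ≈⟨ ⋆-unfold f a n ⟩
    f 0 * a (suc n) + (div-z f ⋆ a) n  ≈⟨ +-cong (constantFree-* f₀ _) refl ⟩
    0# + (div-z f ⋆ a) n               ≈⟨ +-identityˡ _ ⟩
    (div-z f ⋆ a) n                    ∎

  ⋆-contract : ∀ {f} → ConstantFree f → ∀ n {x y} → x ≃[ n ] y → f ⋆ x ≃[ suc n ] f ⋆ y
  ⋆-contract f₀ n x≃y zero    _ = trans (constantFree-* f₀ _) (sym (constantFree-* f₀ _))
  ⋆-contract {f} f₀ n {x} {y} x≃y (suc m) (s≤s m<n) = begin
    (f ⋆ x) (suc m)                     ≈⟨ ⋆-unfold f x m ⟩
    f 0 * x (suc m) + (div-z f ⋆ x) m    ≈⟨ +-cong (trans (constantFree-* f₀ _) (sym (constantFree-* f₀ _)))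
                                                  (⋆-cong≃ n ≃-refl x≃y m m<n) ⟩
    f 0 * y (suc m) + (div-z f ⋆ y) m    ≈⟨ sym (⋆-unfold f y m) ⟩
    (f ⋆ y) (suc m)                     ∎

  _^_ : Series → ℕ → Series
  f ^ zero  = one
  f ^ suc k = f ⋆ (f ^ k)

  ^-cong : ∀ {f f′} → f ≐ f′ → ∀ k → f ^ k ≐ f′ ^ k
  ^-cong f≐f′ zero    = ≐-refl
  ^-cong f≐f′ (suc k) = ⋆-cong f≐f′ (^-cong f≐f′ k)

  ^-cong≃ : ∀ {f f′ n} → f ≃[ n ] f′ → ∀ k → f ^ k ≃[ n ] f′ ^ k
  ^-cong≃ f≃f′ zero            = ≃-refl
  ^-cong≃ {n = n} f≃f′ (suc k) = ⋆-cong≃ n f≃f′ (^-cong≃ f≃f′ k)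

  -- Composition of series

  riordan : Series → Series → Matrix
  riordan g f m k = (g ⋆ (f ^ k)) m

  applyRiordan : Series → Series → Series → Series
  applyRiordan g f h m = sumTo (λ i → riordan g f m i * h i) m

  -- h ∘ₛ f is h(f(z)); the truncation of the sum at m is harmless for constant-free f.
  _∘ₛ_ : Series → Series → Series
  h ∘ₛ f = applyRiordan one f h

  ∘ₛ-coeff₀ : ∀ h f → (h ∘ₛ f) 0 ≈ h 0
  ∘ₛ-coeff₀ h f = trans (*-cong (*-identityˡ 1#) refl) (*-identityˡ _)

  applyRiordan-unfold : ∀ {f} → ConstantFree f → ∀ a h m →
    applyRiordan a f h (suc m) ≈ a (suc m) * h 0 + applyRiordan (div-z (a ⋆ f)) f (div-z h) m
  applyRiordan-unfold {f} f₀ a h m =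
    trans (sumTo-unfold _ m) (+-cong (*-cong (⋆-one a (suc m)) refl) (sumTo-cong m (λ i _ → *-cong (entry i) refl)))
    where
    entry : ∀ i → (a ⋆ (f ^ suc i)) (suc m) ≈ (div-z (a ⋆ f) ⋆ (f ^ i)) m
    entry i = begin
      (a ⋆ (f ⋆ (f ^ i))) (suc m)                                 ≈⟨ sym (⋆-assoc a f (f ^ i) (suc m)) ⟩
      ((a ⋆ f) ⋆ (f ^ i)) (suc m)                                 ≈⟨ ⋆-unfold (a ⋆ f) (f ^ i) m ⟩
      (a ⋆ f) 0 * (f ^ i) (suc m) + (div-z (a ⋆ f) ⋆ (f ^ i)) m    ≈⟨ +-cong (constantFree-* (constantFree-⋆ʳ f₀ a) _) refl ⟩
      0# + (div-z (a ⋆ f) ⋆ (f ^ i)) m                            ≈⟨ +-identityˡ _ ⟩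
      (div-z (a ⋆ f) ⋆ (f ^ i)) m                                 ∎

  div-z-∘ₛ : ∀ {f} → ConstantFree f → ∀ h → div-z (h ∘ₛ f) ≐ applyRiordan (div-z f) f (div-z h)
  div-z-∘ₛ {f} f₀ h m = begin
    (h ∘ₛ f) (suc m)                                                ≈⟨ applyRiordan-unfold f₀ one h m ⟩
    0# * h 0 + applyRiordan (div-z (one ⋆ f)) f (div-z h) m          ≈⟨ +-cong (zeroˡ _) (sumTo-cong m (λ i _ →
                                                                          *-cong (⋆-congˡ (f ^ i) (λ k → one-⋆ f (suc k)) m) refl)) ⟩
    0# + applyRiordan (div-z f) f (div-z h) m                        ≈⟨ +-identityˡ _ ⟩
    applyRiordan (div-z f) f (div-z h) m                             ∎

  -- Stated up to order n so that the recursion through div-z (h ∘ₛ f) is structural.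
  applyRiordan-≃ : ∀ {f} → ConstantFree f → ∀ n a h → applyRiordan a f h ≃[ n ] a ⋆ (h ∘ₛ f)
  applyRiordan-≃ {f} f₀ (suc n) a h zero    _ =
    trans (*-assoc _ _ _) (*-cong refl (*-cong (sym (*-identityˡ 1#)) refl))
  applyRiordan-≃ {f} f₀ (suc n) a h (suc m) (s≤s m<n) = begin
    applyRiordan a f h (suc m)
      ≈⟨ applyRiordan-unfold f₀ a h m ⟩
    a (suc m) * h 0 + applyRiordan (div-z (a ⋆ f)) f (div-z h) m
      ≈⟨ +-cong (*-comm _ _) (trans (applyRiordan-≃ f₀ n (div-z (a ⋆ f)) (div-z h) m m<n)
                                     (⋆-congˡ h′ (div-z-⋆-constantFree f₀ a) m)) ⟩
    h 0 * a (suc m) + ((div-z f ⋆ a) ⋆ h′) m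
      ≈⟨ +-cong (*-cong (sym (∘ₛ-coeff₀ h f)) refl) (trans (⋆-swapʳ (div-z f) a h′ m)
                                                           (⋆-cong≃ {b = a} {b′ = a} (suc m) tail≃ ≃-refl m (n<1+n m))) ⟩
    (h ∘ₛ f) 0 * a (suc m) + (div-z (h ∘ₛ f) ⋆ a) m
      ≈⟨ sym (trans (⋆-comm a (h ∘ₛ f) (suc m)) (⋆-unfold (h ∘ₛ f) a m)) ⟩
    (a ⋆ (h ∘ₛ f)) (suc m) ∎
    where
    h′ = div-z h ∘ₛ f
    tail≃ : div-z f ⋆ h′ ≃[ suc m ] div-z (h ∘ₛ f)
    tail≃ q q<sm = sym (trans (div-z-∘ₛ f₀ h q) (applyRiordan-≃ f₀ n (div-z f) (div-z h) q (<-≤-trans q<sm m<n)))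

  applyRiordan-⋆∘ₛ : ∀ {f} → ConstantFree f → ∀ a h → applyRiordan a f h ≐ a ⋆ (h ∘ₛ f)
  applyRiordan-⋆∘ₛ f₀ a h n = applyRiordan-≃ f₀ (suc n) a h n (n<1+n n)

  ∘ₛ-unfold : ∀ {f} → ConstantFree f → ∀ h → h ∘ₛ f ≐ const (h 0) ⊕ (f ⋆ (div-z h ∘ₛ f))
  ∘ₛ-unfold {f} f₀ h zero = begin
    (h ∘ₛ f) 0                      ≈⟨ ∘ₛ-coeff₀ h f ⟩
    h 0                             ≈⟨ sym (trans (+-cong (*-identityʳ _) (constantFree-* f₀ _)) (+-identityʳ _)) ⟩
    h 0 * 1# + f 0 * (div-z h ∘ₛ f) 0 ∎
  ∘ₛ-unfold {f} f₀ h (suc m) = begin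
    (h ∘ₛ f) (suc m)                           ≈⟨ trans (div-z-∘ₛ f₀ h m) (applyRiordan-⋆∘ₛ f₀ (div-z f) (div-z h) m) ⟩
    (div-z f ⋆ h′) m                           ≈⟨ sym (+-identityˡ _) ⟩
    0# + (div-z f ⋆ h′) m                      ≈⟨ sym (+-cong (constantFree-* f₀ _) refl) ⟩
    f 0 * h′ (suc m) + (div-z f ⋆ h′) m         ≈⟨ sym (⋆-unfold f h′ m) ⟩
    (f ⋆ h′) (suc m)                           ≈⟨ sym (trans (+-cong (zeroʳ _) refl) (+-identityˡ _)) ⟩
    h 0 * 0# + (f ⋆ h′) (suc m)                ∎
    where h′ = div-z h ∘ₛ f

  ∘ₛ-congˡ : ∀ {h h′} f → h ≐ h′ → h ∘ₛ f ≐ h′ ∘ₛ f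
  ∘ₛ-congˡ f h≐h′ m = sumTo-cong m (λ i _ → *-cong refl (h≐h′ i))

  ∘ₛ-congʳ≃ : ∀ h {f f′ n} → f ≃[ n ] f′ → h ∘ₛ f ≃[ n ] h ∘ₛ f′
  ∘ₛ-congʳ≃ h {n = n} f≃f′ m m<n = sumTo-cong m (λ i _ → *-cong (⋆-cong≃ n ≃-refl (^-cong≃ f≃f′ i) m m<n) refl)

  ∘ₛ-congʳ : ∀ h {f f′} → f ≐ f′ → h ∘ₛ f ≐ h ∘ₛ f′
  ∘ₛ-congʳ h f≐f′ m = ∘ₛ-congʳ≃ h (≐⇒≃ {n = suc m} f≐f′) m (n<1+n m)

  ⊕-∘ₛ : ∀ h k f → (h ⊕ k) ∘ₛ f ≐ (h ∘ₛ f) ⊕ (k ∘ₛ f)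
  ⊕-∘ₛ h k f m = trans (sumTo-cong m (λ i _ → distribˡ _ _ _)) (sumTo-+ _ _ m)

  ·-∘ₛ : ∀ s h f → (s · h) ∘ₛ f ≐ s · (h ∘ₛ f)
  ·-∘ₛ s h f m = trans (sumTo-cong m (λ i _ → x∙yz≈y∙xz _ _ _)) (sumTo-*ˡ s _ m)

  one-∘ₛ : ∀ {f} → ConstantFree f → one ∘ₛ f ≐ one
  one-∘ₛ {f} f₀ n = begin
    (one ∘ₛ f) n                  ≈⟨ ∘ₛ-unfold f₀ one n ⟩
    1# * one n + (f ⋆ (𝟘 ∘ₛ f)) n  ≈⟨ +-cong (*-identityˡ _) (trans (⋆-congʳ f 𝟘-∘ₛ n) (⋆-𝟘 f n)) ⟩
    one n + 0#                    ≈⟨ +-identityʳ _ ⟩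
    one n                         ∎
    where
    𝟘-∘ₛ : 𝟘 ∘ₛ f ≐ 𝟘
    𝟘-∘ₛ m = sumTo-zero m (λ i _ → zeroʳ _)

  const-∘ₛ : ∀ {f} → ConstantFree f → ∀ s → const s ∘ₛ f ≐ const s
  const-∘ₛ f₀ s n = trans (·-∘ₛ s one _ n) (*-cong refl (one-∘ₛ f₀ n))

  zS-∘ₛ : ∀ {f} → ConstantFree f → zS ∘ₛ f ≐ f
  zS-∘ₛ {f} f₀ n = begin
    (zS ∘ₛ f) n                             ≈⟨ ∘ₛ-unfold f₀ zS n ⟩
    0# * one n + (f ⋆ (div-z zS ∘ₛ f)) n     ≈⟨ +-cong (zeroˡ _) (⋆-congʳ f (≐-trans (∘ₛ-congˡ f div-z-zS) (one-∘ₛ f₀)) n) ⟩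
    0# + (f ⋆ one) n                        ≈⟨ +-identityˡ _ ⟩
    (f ⋆ one) n                             ≈⟨ ⋆-one f n ⟩
    f n                                     ∎

  ∘ₛ-zS : ∀ h → h ∘ₛ zS ≐ h
  ∘ₛ-zS h zero    = ∘ₛ-coeff₀ h zS
  ∘ₛ-zS h (suc n) = begin
    (h ∘ₛ zS) (suc n)                           ≈⟨ ∘ₛ-unfold constantFree-zS h (suc n) ⟩
    h 0 * 0# + (zS ⋆ (div-z h ∘ₛ zS)) (suc n)   ≈⟨ +-cong (zeroʳ _) (zS-⋆ (div-z h ∘ₛ zS) (suc n)) ⟩
    0# + (div-z h ∘ₛ zS) n                      ≈⟨ +-identityˡ _ ⟩
    (div-z h ∘ₛ zS) n                           ≈⟨ ∘ₛ-zS (div-z h) n ⟩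
    h (suc n)                                   ∎

  ∘ₛ-coeff₁ : ∀ {f} → ConstantFree f → ∀ h → (h ∘ₛ f) 1 ≈ h 1 * f 1
  ∘ₛ-coeff₁ {f} f₀ h = begin
    (h ∘ₛ f) 1                      ≈⟨ ∘ₛ-unfold f₀ h 1 ⟩
    h 0 * 0# + (f ⋆ h′) 1            ≈⟨ +-cong (zeroʳ _) (⋆-unfold f h′ 0) ⟩
    0# + (f 0 * h′ 1 + f 1 * h′ 0)   ≈⟨ +-identityˡ _ ⟩
    f 0 * h′ 1 + f 1 * h′ 0          ≈⟨ +-cong (constantFree-* f₀ _) (*-cong refl (∘ₛ-coeff₀ (div-z h) f)) ⟩
    0# + f 1 * h 1                   ≈⟨ trans (+-identityˡ _) (*-comm _ _) ⟩
    h 1 * f 1                        ∎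
    where h′ = div-z h ∘ₛ f

  constantFree-∘ₛ : ∀ {h} f → ConstantFree h → ConstantFree (h ∘ₛ f)
  constantFree-∘ₛ {h} f (constantFree h₀≈0) = constantFree (trans (∘ₛ-coeff₀ h f) h₀≈0)

  ⋆-∘ₛ≃ : ∀ {f} → ConstantFree f → ∀ n a b → (a ⋆ b) ∘ₛ f ≃[ n ] (a ∘ₛ f) ⋆ (b ∘ₛ f)
  ⋆-∘ₛ≃ {f} f₀ (suc n) a b m m<sn = begin
    ((a ⋆ b) ∘ₛ f) m
      ≈⟨ ∘ₛ-unfold f₀ (a ⋆ b) m ⟩
    (const (a 0 * b 0) ⊕ (f ⋆ (div-z (a ⋆ b) ∘ₛ f))) m
      ≈⟨ +-cong (sym (trans (const-⋆ (a 0) B m) (sym (*-assoc _ _ _)))) (⋆-contract f₀ n tail≃ m m<sn) ⟩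
    ((A ⋆ B) ⊕ (f ⋆ ((A ⋆ b′) ⊕ (a′ ⋆ (B ⊕ (f ⋆ b′)))))) m
      ≈⟨ expand A B f a′ b′ m ⟩
    ((A ⊕ (f ⋆ a′)) ⋆ (B ⊕ (f ⋆ b′))) m
      ≈⟨ sym (⋆-cong (∘ₛ-unfold f₀ a) (∘ₛ-unfold f₀ b) m) ⟩
    ((a ∘ₛ f) ⋆ (b ∘ₛ f)) m ∎
    where
    A = const (a 0)
    B = const (b 0)
    a′ = div-z a ∘ₛ f
    b′ = div-z b ∘ₛ f
    tail≃ : div-z (a ⋆ b) ∘ₛ f ≃[ n ] (A ⋆ b′) ⊕ (a′ ⋆ (B ⊕ (f ⋆ b′)))
    tail≃ q q<n = begin
      (div-z (a ⋆ b) ∘ₛ f) q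
        ≈⟨ trans (∘ₛ-congˡ f (div-z-⋆ a b) q) (⊕-∘ₛ _ _ f q) ⟩
      ((a 0 · div-z b) ∘ₛ f) q + ((div-z a ⋆ b) ∘ₛ f) q
        ≈⟨ +-cong (trans (·-∘ₛ (a 0) (div-z b) f q) (sym (const-⋆ (a 0) b′ q))) (⋆-∘ₛ≃ f₀ n (div-z a) b q q<n) ⟩
      (A ⋆ b′) q + (a′ ⋆ (b ∘ₛ f)) q
        ≈⟨ +-cong refl (⋆-congʳ a′ (∘ₛ-unfold f₀ b) q) ⟩
      (A ⋆ b′) q + (a′ ⋆ (B ⊕ (f ⋆ b′))) q ∎
    open import Algebra.Solver.Ring.NaturalCoefficients.Default seriesSemiring
    expand : ∀ A B f x y → (A ⋆ B) ⊕ (f ⋆ ((A ⋆ y) ⊕ (x ⋆ (B ⊕ (f ⋆ y))))) ≐ (A ⊕ (f ⋆ x)) ⋆ (B ⊕ (f ⋆ y))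
    expand = solve 5 (λ A B f x y → (A :* B) :+ (f :* ((A :* y) :+ (x :* (B :+ (f :* y)))))
                                    := (A :+ (f :* x)) :* (B :+ (f :* y))) ≐-refl

  ⋆-∘ₛ : ∀ {f} → ConstantFree f → ∀ a b → (a ⋆ b) ∘ₛ f ≐ (a ∘ₛ f) ⋆ (b ∘ₛ f)
  ⋆-∘ₛ f₀ a b m = ⋆-∘ₛ≃ f₀ (suc m) a b m (n<1+n m)

  ^-∘ₛ : ∀ {f} → ConstantFree f → ∀ h k → (h ^ k) ∘ₛ f ≐ (h ∘ₛ f) ^ k
  ^-∘ₛ f₀ h zero    = one-∘ₛ f₀
  ^-∘ₛ f₀ h (suc k) = ≐-trans (⋆-∘ₛ f₀ h (h ^ k)) (⋆-congʳ (h ∘ₛ _) (^-∘ₛ f₀ h k))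

  ∘ₛ-assoc≃ : ∀ {f g} → ConstantFree f → ConstantFree g → ∀ n h → (h ∘ₛ f) ∘ₛ g ≃[ n ] h ∘ₛ (f ∘ₛ g)
  ∘ₛ-assoc≃ {f} {g} f₀ g₀ (suc n) h m m<sn = begin
    ((h ∘ₛ f) ∘ₛ g) m
      ≈⟨ trans (∘ₛ-congˡ g (∘ₛ-unfold f₀ h) m) (⊕-∘ₛ _ _ g m) ⟩
    (const (h 0) ∘ₛ g) m + ((f ⋆ h′) ∘ₛ g) m
      ≈⟨ +-cong (const-∘ₛ g₀ (h 0) m) (⋆-∘ₛ g₀ f h′ m) ⟩
    const (h 0) m + ((f ∘ₛ g) ⋆ (h′ ∘ₛ g)) m
      ≈⟨ +-cong refl (⋆-contract (constantFree-∘ₛ g f₀) n (∘ₛ-assoc≃ f₀ g₀ n (div-z h)) m m<sn) ⟩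
    const (h 0) m + ((f ∘ₛ g) ⋆ (div-z h ∘ₛ (f ∘ₛ g))) m
      ≈⟨ sym (∘ₛ-unfold (constantFree-∘ₛ g f₀) h m) ⟩
    (h ∘ₛ (f ∘ₛ g)) m ∎
    where h′ = div-z h ∘ₛ f

  ∘ₛ-assoc : ∀ {f g} → ConstantFree f → ConstantFree g → ∀ h → (h ∘ₛ f) ∘ₛ g ≐ h ∘ₛ (f ∘ₛ g)
  ∘ₛ-assoc f₀ g₀ h m = ∘ₛ-assoc≃ f₀ g₀ (suc m) h m (n<1+n m)

  -- Substitution z ↦ z²

  sub-z²-cong : ∀ {g g′} → g ≐ g′ → sub-z² g ≐ sub-z² g′
  sub-z²-cong g≐g′ zero          = g≐g′ 0
  sub-z²-cong g≐g′ (suc zero)    = refl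
  sub-z²-cong g≐g′ (suc (suc n)) = sub-z²-cong (λ k → g≐g′ (suc k)) n

  sub-z²-⊕ : ∀ a b → sub-z² (a ⊕ b) ≐ sub-z² a ⊕ sub-z² b
  sub-z²-⊕ a b zero          = refl
  sub-z²-⊕ a b (suc zero)    = sym (+-identityʳ 0#)
  sub-z²-⊕ a b (suc (suc n)) = sub-z²-⊕ (div-z a) (div-z b) n

  sub-z²-· : ∀ s a → sub-z² (s · a) ≐ s · sub-z² a
  sub-z²-· s a zero          = refl
  sub-z²-· s a (suc zero)    = sym (zeroʳ _)
  sub-z²-· s a (suc (suc n)) = sub-z²-· s (div-z a) n

  sub-z²-𝟘 : sub-z² 𝟘 ≐ 𝟘
  sub-z²-𝟘 zero          = refl
  sub-z²-𝟘 (suc zero)    = refl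
  sub-z²-𝟘 (suc (suc n)) = sub-z²-𝟘 n

  sub-z²-one : sub-z² one ≐ one
  sub-z²-one zero          = refl
  sub-z²-one (suc zero)    = refl
  sub-z²-one (suc (suc n)) = sub-z²-𝟘 n

  sub-z²-⋆ : ∀ a b → sub-z² (a ⋆ b) ≐ sub-z² a ⋆ sub-z² b
  sub-z²-⋆ a b zero          = refl
  sub-z²-⋆ a b (suc zero)    = sym (trans (+-cong (zeroʳ _) (zeroˡ _)) (+-identityʳ 0#))
  sub-z²-⋆ a b (suc (suc n)) = begin
    sub-z² (div-z (a ⋆ b)) n
      ≈⟨ trans (sub-z²-cong (div-z-⋆ a b) n) (sub-z²-⊕ _ _ n) ⟩
    sub-z² (a 0 · div-z b) n + sub-z² (div-z a ⋆ b) n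
      ≈⟨ +-cong (sub-z²-· (a 0) (div-z b) n) (sub-z²-⋆ (div-z a) b n) ⟩
    a 0 * sub-z² (div-z b) n + (sub-z² (div-z a) ⋆ sub-z² b) n
      ≈⟨ +-cong refl (sym (trans (+-cong (zeroˡ _) refl) (+-identityˡ _))) ⟩
    a 0 * sub-z² b (suc (suc n)) + (0# * sub-z² b (suc n) + (sub-z² (div-z a) ⋆ sub-z² b) n)
      ≈⟨ sym (trans (⋆-unfold (sub-z² a) (sub-z² b) (suc n)) (+-cong refl (⋆-unfold (div-z (sub-z² a)) (sub-z² b) n))) ⟩
    (sub-z² a ⋆ sub-z² b) (suc (suc n)) ∎

  sub-z²-^ : ∀ f k → sub-z² (f ^ k) ≐ sub-z² f ^ k
  sub-z²-^ f zero    = sub-z²-one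
  sub-z²-^ f (suc k) = ≐-trans (sub-z²-⋆ f (f ^ k)) (⋆-congʳ (sub-z² f) (sub-z²-^ f k))

  sub-z²-even : ∀ s n → sub-z² s (n ℕ+ n) ≈ s n
  sub-z²-even s zero = refl
  sub-z²-even s (suc n) rewrite +-suc n n = sub-z²-even (div-z s) n

  sub-z²-odd : ∀ s n → sub-z² s (suc (n ℕ+ n)) ≈ 0#
  sub-z²-odd s zero = refl
  sub-z²-odd s (suc n) rewrite +-suc n n = sub-z²-odd (div-z s) n

  -- Fixpoints, reciprocals and compositional inverses

  Contractive : (Series → Series) → Set (c ⊔ ℓ)
  Contractive Φ = ∀ n x y → x ≃[ n ] y → Φ x ≃[ suc n ] Φ y

  iterate : (Series → Series) → ℕ → Series
  iterate Φ zero    = 𝟘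
  iterate Φ (suc k) = Φ (iterate Φ k)

  -- The n-th coefficient has stabilised after n + 1 iterations.
  fix : (Series → Series) → Series
  fix Φ n = iterate Φ (suc n) n

  iterate-stable : ∀ {Φ} → Contractive Φ → ∀ k j → iterate Φ k ≃[ k ] iterate Φ (k ℕ+ j)
  iterate-stable Φ-contr zero    j m ()
  iterate-stable Φ-contr (suc k) j = Φ-contr k _ _ (iterate-stable Φ-contr k j)

  fix≃iterate : ∀ {Φ} → Contractive Φ → ∀ n → fix Φ ≃[ n ] iterate Φ n
  fix≃iterate {Φ} Φ-contr n m m<n =
    P.subst (λ N → iterate Φ (suc m) m ≈ iterate Φ N m) (m+[n∸m]≡n m<n)
            (iterate-stable Φ-contr (suc m) (n ∸ suc m) m (n<1+n m))

  fix-unfold : ∀ {Φ} → Contractive Φ → fix Φ ≐ Φ (fix Φ)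
  fix-unfold Φ-contr n = sym (Φ-contr n _ _ (fix≃iterate Φ-contr n) n (n<1+n n))

  fix-cong≃ : ∀ {Φ Ψ} → Contractive Φ → Contractive Ψ → ∀ n → (∀ x → Φ x ≃[ n ] Ψ x) → fix Φ ≃[ n ] fix Ψ
  fix-cong≃ {Φ} {Ψ} Φ-contr Ψ-contr n Φ≃Ψ = below n ≤-refl
    where
    below : ∀ k → k ≤ n → fix Φ ≃[ k ] fix Ψ
    below zero    _    m ()
    below (suc k) sk≤n m m<sk = begin
      fix Φ m         ≈⟨ fix-unfold Φ-contr m ⟩
      Φ (fix Φ) m     ≈⟨ Φ-contr k _ _ (below k (≤-trans (n≤1+n k) sk≤n)) m m<sk ⟩
      Φ (fix Ψ) m     ≈⟨ Φ≃Ψ (fix Ψ) m (<-≤-trans m<sk sk≤n) ⟩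
      Ψ (fix Ψ) m     ≈⟨ sym (fix-unfold Ψ-contr m) ⟩
      fix Ψ m         ∎

  reciprocalStep : Carrier → Series → Series → Series
  reciprocalStep u g x zero    = u
  reciprocalStep u g x (suc n) = - (u * (div-z g ⋆ x) n)

  reciprocalStep-contractive : ∀ u g → Contractive (reciprocalStep u g)
  reciprocalStep-contractive u g n x y x≃y zero    _         = refl
  reciprocalStep-contractive u g n x y x≃y (suc m) (s≤s m<n) = -‿cong (*-cong refl (⋆-cong≃ n ≃-refl x≃y m m<n))

  reciprocal : Carrier → Series → Series
  reciprocal u g = fix (reciprocalStep u g)

  ⋆-reciprocal : ∀ u g → g 0 * u ≈ 1# → g ⋆ reciprocal u g ≐ one
  ⋆-reciprocal u g g₀u≈1 zero    = g₀u≈1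
  ⋆-reciprocal u g g₀u≈1 (suc n) = begin
    (g ⋆ x) (suc n)             ≈⟨ ⋆-unfold g x n ⟩
    g 0 * x (suc n) + t         ≈⟨ +-cong (*-cong refl (fix-unfold (reciprocalStep-contractive u g) (suc n))) refl ⟩
    g 0 * (- (u * t)) + t       ≈⟨ +-cong (sym (-‿distribʳ-* _ _)) refl ⟩
    - (g 0 * (u * t)) + t       ≈⟨ +-cong (-‿cong (trans (sym (*-assoc _ _ _)) (trans (*-cong g₀u≈1 refl) (*-identityˡ _)))) refl ⟩
    - t + t                     ≈⟨ -‿inverseˡ t ⟩
    0#                          ∎
    where
    x = reciprocal u g
    t = (div-z g ⋆ x) n

  reciprocal-cong≃ : ∀ u {g g′ n} → g ≃[ n ] g′ → reciprocal u g ≃[ n ] reciprocal u g′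
  reciprocal-cong≃ u {g} {g′} {n} g≃g′ =
    fix-cong≃ (reciprocalStep-contractive u g) (reciprocalStep-contractive u g′) n step≃
    where
    step≃ : ∀ x → reciprocalStep u g x ≃[ n ] reciprocalStep u g′ x
    step≃ x zero    _    = refl
    step≃ x (suc m) sm<n = -‿cong (*-cong refl (⋆-cong≃ {b = x} {b′ = x} (suc m) tail≃ ≃-refl m (n<1+n m)))
      where
      tail≃ : div-z g ≃[ suc m ] div-z g′
      tail≃ q q<sm = g≃g′ (suc q) (<-≤-trans (s≤s q<sm) sm<n)

  -- Writing f = z φ and f̂ = z ψ, the equation f(f̂) = z becomes the contractive
  -- fixpoint equation ψ = 1 / φ(z ψ).
  module CompositionalInverse (f : Series) (u : Carrier) where

    invStep : Series → Series
    invStep ψ = reciprocal u (div-z f ∘ₛ (zS ⋆ ψ))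

    invStep-contractive : Contractive invStep
    invStep-contractive n x y x≃y =
      reciprocal-cong≃ u (∘ₛ-congʳ≃ (div-z f) (⋆-contract constantFree-zS n x≃y))

    f̂ : Series
    f̂ = zS ⋆ fix invStep

    constantFree-f̂ : ConstantFree f̂
    constantFree-f̂ = constantFree (zeroˡ _)

    f̂-coeff₁ : f̂ 1 ≈ u
    f̂-coeff₁ = zS-⋆ (fix invStep) 1

    ∘ₛ-f̂ : ConstantFree f → f 1 * u ≈ 1# → f ∘ₛ f̂ ≐ zS
    ∘ₛ-f̂ f₀ f₁u≈1 n = begin
      (f ∘ₛ f̂) n                       ≈⟨ ∘ₛ-congˡ f̂ (≐-sym (zS-⋆-div-z f₀)) n ⟩
      ((zS ⋆ div-z f) ∘ₛ f̂) n          ≈⟨ ⋆-∘ₛ constantFree-f̂ zS (div-z f) n ⟩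
      ((zS ∘ₛ f̂) ⋆ φ̂) n                ≈⟨ ⋆-congˡ φ̂ (zS-∘ₛ constantFree-f̂) n ⟩
      (f̂ ⋆ φ̂) n                        ≈⟨ ⋆-assoc zS ψ φ̂ n ⟩
      (zS ⋆ (ψ ⋆ φ̂)) n                 ≈⟨ ⋆-congʳ zS (⋆-congˡ φ̂ (fix-unfold invStep-contractive)) n ⟩
      (zS ⋆ (reciprocal u φ̂ ⋆ φ̂)) n    ≈⟨ ⋆-congʳ zS (≐-trans (⋆-comm _ φ̂) (⋆-reciprocal u φ̂ φ̂₀u≈1)) n ⟩
      (zS ⋆ one) n                     ≈⟨ ⋆-one zS n ⟩
      zS n                             ∎
      where
      ψ = fix invStep
      φ̂ = div-z f ∘ₛ f̂
      φ̂₀u≈1 : φ̂ 0 * u ≈ 1#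
      φ̂₀u≈1 = trans (*-cong (∘ₛ-coeff₀ (div-z f) f̂) refl) f₁u≈1

data Parity : ℕ → Set where
  even : ∀ m → Parity (m ℕ+ m)
  odd  : ∀ m → Parity (suc (m ℕ+ m))

parity : ∀ n → Parity n
parity zero = even 0
parity (suc n) with parity n
... | even m = odd m
... | odd m  = P.subst Parity (P.cong suc (+-suc m m)) (even (suc m))

module Doubling {c ℓ} (K : CommutativeRing c ℓ) where
  open CommutativeRing K hiding (zero)
  open DR K
  open PowerSeries K
  open SetoidR setoid

  record Doubles (M R : Matrix) : Set ℓ where
    field
      even-even : ∀ m k → M (m ℕ+ m) (k ℕ+ k) ≈ R m k
      odd-odd   : ∀ m k → M (suc (m ℕ+ m)) (suc (k ℕ+ k)) ≈ R m k
      even-odd  : ∀ m k → M (m ℕ+ m) (suc (k ℕ+ k)) ≈ 0#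
      odd-even  : ∀ m k → M (suc (m ℕ+ m)) (k ℕ+ k) ≈ 0#
  open Doubles

  doubles-unique : ∀ {M M′ R} → Doubles M R → Doubles M′ R → M ≋ M′
  doubles-unique d d′ n k with parity n | parity k
  ... | even m | even j = trans (even-even d m j) (sym (even-even d′ m j))
  ... | odd m  | odd j  = trans (odd-odd d m j)   (sym (odd-odd d′ m j))
  ... | even m | odd j  = trans (even-odd d m j)  (sym (even-odd d′ m j))
  ... | odd m  | even j = trans (odd-even d m j)  (sym (odd-even d′ m j))

  doubles-respˡ : ∀ {M M′ R} → M′ ≋ M → Doubles M R → Doubles M′ R
  doubles-respˡ M′≋M d = record
    { even-even = λ m k → trans (M′≋M _ _) (even-even d m k)
    ; odd-odd   = λ m k → trans (M′≋M _ _) (odd-odd d m k)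
    ; even-odd  = λ m k → trans (M′≋M _ _) (even-odd d m k)
    ; odd-even  = λ m k → trans (M′≋M _ _) (odd-even d m k) }

  doubles-respʳ : ∀ {M R R′} → R ≋ R′ → Doubles M R → Doubles M R′
  doubles-respʳ R≋R′ d = record
    { even-even = λ m k → trans (even-even d m k) (R≋R′ m k)
    ; odd-odd   = λ m k → trans (odd-odd d m k) (R≋R′ m k)
    ; even-odd  = even-odd d
    ; odd-even  = odd-even d }

  sumTo-evens : ∀ f m → (∀ i → f (suc (i ℕ+ i)) ≈ 0#) → sumTo f (m ℕ+ m) ≈ sumTo (λ i → f (i ℕ+ i)) m
  sumTo-evens f zero    odd≈0 = refl
  sumTo-evens f (suc m) odd≈0 rewrite +-suc m m =
    +-cong (trans (+-cong (sumTo-evens f m odd≈0) (odd≈0 m)) (+-identityʳ _)) refl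

  sumTo-odds : ∀ f m → (∀ i → f (i ℕ+ i) ≈ 0#) → sumTo f (suc (m ℕ+ m)) ≈ sumTo (λ i → f (suc (i ℕ+ i))) m
  sumTo-odds f zero    even≈0 = trans (+-cong (even≈0 0) refl) (+-identityˡ _)
  sumTo-odds f (suc m) even≈0 rewrite +-suc m m =
    +-cong (trans (+-cong (sumTo-odds f m even≈0) next≈0) (+-identityʳ _)) refl
    where
    next≈0 : f (suc (suc (m ℕ+ m))) ≈ 0#
    next≈0 = P.subst (λ t → f (suc t) ≈ 0#) (+-suc m m) (even≈0 (suc m))

  doubles-⊗ : ∀ {A B R R′} → Doubles A R → Doubles B R′ → Doubles (A ⊗ B) (R ⊗ R′)
  doubles-⊗ {A} {B} {R} {R′} dA dB = record
    { even-even = λ m k → trans (evenRow m) (sumTo-cong m (λ i _ → *-cong (even-even dA m i) (even-even dB i k)))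
    ; odd-odd   = λ m k → trans (oddRow m)  (sumTo-cong m (λ i _ → *-cong (odd-odd dA m i) (odd-odd dB i k)))
    ; even-odd  = λ m k → trans (evenRow m) (sumTo-zero m (λ i _ → trans (*-cong refl (even-odd dB i k)) (zeroʳ _)))
    ; odd-even  = λ m k → trans (oddRow m)  (sumTo-zero m (λ i _ → trans (*-cong refl (odd-even dB i k)) (zeroʳ _))) }
    where
    evenRow : ∀ m {k} → (A ⊗ B) (m ℕ+ m) k ≈ sumTo (λ i → A (m ℕ+ m) (i ℕ+ i) * B (i ℕ+ i) k) m
    evenRow m = sumTo-evens _ m (λ i → trans (*-cong (even-odd dA m i) refl) (zeroˡ _))
    oddRow : ∀ m {k} → (A ⊗ B) (suc (m ℕ+ m)) k ≈ sumTo (λ i → A (suc (m ℕ+ m)) (suc (i ℕ+ i)) * B (suc (i ℕ+ i)) k) m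
    oddRow m = sumTo-odds _ m (λ i → trans (*-cong (odd-even dA m i) refl) (zeroˡ _))

  doubles-Id : Doubles Id Id
  doubles-Id = record
    { even-even = λ m k → reflexive (Id-even m k)
    ; odd-odd   = λ m k → reflexive (Id-even m k)
    ; even-odd  = λ m k → reflexive (Id-even-odd m k)
    ; odd-even  = λ m k → reflexive (Id-odd-even m k) }
    where
    Id-even : ∀ m k → Id (m ℕ+ m) (k ℕ+ k) ≡ Id m k
    Id-even zero    zero    = P.refl
    Id-even zero    (suc k) = P.refl
    Id-even (suc m) zero    = P.refl
    Id-even (suc m) (suc k) rewrite +-suc m m | +-suc k k = Id-even m k
    Id-even-odd : ∀ m k → Id (m ℕ+ m) (suc (k ℕ+ k)) ≡ 0#
    Id-odd-even : ∀ m k → Id (suc (m ℕ+ m)) (k ℕ+ k) ≡ 0#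
    Id-even-odd zero    k = P.refl
    Id-even-odd (suc m) k rewrite +-suc m m = Id-odd-even m k
    Id-odd-even m zero    = P.refl
    Id-odd-even m (suc k) rewrite +-suc k k = Id-even-odd m k

  riordan-cong : ∀ {g g′ f f′} → g ≐ g′ → f ≐ f′ → riordan g f ≋ riordan g′ f′
  riordan-cong g≐g′ f≐f′ m k = ⋆-cong g≐g′ (^-cong f≐f′ k) m

  riordan-one-zS : riordan one zS ≋ Id
  riordan-one-zS m k = trans (one-⋆ (zS ^ k) m) (zS^ k m)
    where
    zS^ : ∀ k m → (zS ^ k) m ≈ Id m k
    zS^ zero    zero    = refl
    zS^ zero    (suc m) = refl
    zS^ (suc k) zero    = zeroˡ _
    zS^ (suc k) (suc m) = trans (zS-⋆ (zS ^ k) (suc m)) (zS^ k m)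

  riordan-⊗ : ∀ g₁ {f₁} g₂ f₂ → ConstantFree f₁ →
    (riordan g₁ f₁ ⊗ riordan g₂ f₂) ≋ riordan (g₁ ⋆ (g₂ ∘ₛ f₁)) (f₂ ∘ₛ f₁)
  riordan-⊗ g₁ {f₁} g₂ f₂ f₁₀ m k = begin
    applyRiordan g₁ f₁ (g₂ ⋆ (f₂ ^ k)) m             ≈⟨ applyRiordan-⋆∘ₛ f₁₀ g₁ (g₂ ⋆ (f₂ ^ k)) m ⟩
    (g₁ ⋆ ((g₂ ⋆ (f₂ ^ k)) ∘ₛ f₁)) m                 ≈⟨ ⋆-congʳ g₁ (≐-trans (⋆-∘ₛ f₁₀ g₂ (f₂ ^ k))
                                                                   (⋆-congʳ (g₂ ∘ₛ f₁) (^-∘ₛ f₁₀ f₂ k))) m ⟩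
    (g₁ ⋆ ((g₂ ∘ₛ f₁) ⋆ ((f₂ ∘ₛ f₁) ^ k))) m         ≈⟨ sym (⋆-assoc g₁ (g₂ ∘ₛ f₁) ((f₂ ∘ₛ f₁) ^ k) m) ⟩
    ((g₁ ⋆ (g₂ ∘ₛ f₁)) ⋆ ((f₂ ∘ₛ f₁) ^ k)) m         ∎

  sArray : Series → Series → Matrix
  sArray g f = DRA (sub-z² g) zS (div-z (sub-z² f))

  shift-even : ∀ y → (∀ m → y (suc (m ℕ+ m)) ≈ 0#) → ∀ m → shift y (m ℕ+ m) ≈ 0#
  shift-even y odd≈0 zero    = refl
  shift-even y odd≈0 (suc m) rewrite +-suc m m = odd≈0 m

  doubles-sArray : ∀ g {f} → ConstantFree f → Doubles (sArray g f) (riordan g f)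
  doubles-sArray g {f} f₀ = record
    { even-even = λ m k → trans (column-even k (m ℕ+ m)) (Y-even k m)
    ; odd-odd   = λ m k → trans (column-odd k (suc (m ℕ+ m))) (trans (zS-⋆ (Y k) (suc (m ℕ+ m))) (Y-even k m))
    ; even-odd  = λ m k → trans (column-odd k (m ℕ+ m)) (trans (zS-⋆ (Y k) (m ℕ+ m)) (shift-even (Y k) (Y-odd k) m))
    ; odd-even  = λ m k → trans (column-even k (suc (m ℕ+ m))) (Y-odd k m) }
    where
    G = sub-z² g
    Φ = sub-z² f
    col = column G zS (div-z Φ)

    column-step : ∀ k → col (suc (suc k)) ≐ col k ⋆ Φ
    column-step k = ≐-trans (⋆-assoc (col k) zS (div-z Φ))
                            (⋆-congʳ (col k) (zS-⋆-div-z {Φ} (constantFree (ConstantFree.constant≈0 f₀))))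

    Y : ℕ → Series
    Y k = G ⋆ (Φ ^ k)

    Y-⋆Φ : ∀ k → Y k ⋆ Φ ≐ Y (suc k)
    Y-⋆Φ k = ≐-trans (⋆-assoc G (Φ ^ k) Φ) (⋆-congʳ G (⋆-comm (Φ ^ k) Φ))

    column-even : ∀ k → col (k ℕ+ k) ≐ Y k
    column-even zero = ≐-sym (⋆-one G)
    column-even (suc k) rewrite +-suc k k =
      ≐-trans (column-step (k ℕ+ k)) (≐-trans (⋆-congˡ Φ (column-even k)) (Y-⋆Φ k))

    column-odd : ∀ k → col (suc (k ℕ+ k)) ≐ zS ⋆ Y k
    column-odd zero = ≐-trans (⋆-comm G zS) (⋆-congʳ zS (≐-sym (⋆-one G)))
    column-odd (suc k) rewrite +-suc k k =
      ≐-trans (column-step (suc (k ℕ+ k)))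
      (≐-trans (⋆-congˡ Φ (column-odd k)) (≐-trans (⋆-assoc zS (Y k) Φ) (⋆-congʳ zS (Y-⋆Φ k))))

    Y-sub-z² : ∀ k → Y k ≐ sub-z² (g ⋆ (f ^ k))
    Y-sub-z² k = ≐-sym (≐-trans (sub-z²-⋆ g (f ^ k)) (⋆-congʳ G (sub-z²-^ f k)))

    Y-even : ∀ k m → Y k (m ℕ+ m) ≈ riordan g f m k
    Y-even k m = trans (Y-sub-z² k (m ℕ+ m)) (sub-z²-even _ m)

    Y-odd : ∀ k m → Y k (suc (m ℕ+ m)) ≈ 0#
    Y-odd k m = trans (Y-sub-z² k (suc (m ℕ+ m))) (sub-z²-odd _ m)

module RiordanGroup {c ℓ} (K : CommutativeRing c ℓ) where
  open DR K
  open PowerSeries K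
  open Doubling K

  RiordanPair : Set c
  RiordanPair = Series × Series

  _≈ᴾ_ : RiordanPair → RiordanPair → Set ℓ
  (g , f) ≈ᴾ (g′ , f′) = (g ≐ g′) × (f ≐ f′)

  pairSetoid : Setoid c ℓ
  pairSetoid = record
    { Carrier = RiordanPair
    ; _≈_ = _≈ᴾ_
    ; isEquivalence = record
      { refl = ≐-refl , ≐-refl
      ; sym = λ (g≐ , f≐) → ≐-sym g≐ , ≐-sym f≐
      ; trans = λ (g≐ , f≐) (g≐′ , f≐′) → ≐-trans g≐ g≐′ , ≐-trans f≐ f≐′ } }

  -- The Riordan group law: riordan g₁ f₁ ⊗ riordan g₂ f₂ = riordan (g₁ g₂(f₁)) (f₂(f₁)).
  _∙_ : RiordanPair → RiordanPair → RiordanPair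
  (g₁ , f₁) ∙ (g₂ , f₂) = g₁ ⋆ (g₂ ∘ₛ f₁) , f₂ ∘ₛ f₁

  ε : RiordanPair
  ε = one , zS

  ConstantFreeᴾ : RiordanPair → Set ℓ
  ConstantFreeᴾ (g , f) = ConstantFree f

  ∙-cong : ∀ {p p′ q q′} → p ≈ᴾ p′ → q ≈ᴾ q′ → (p ∙ q) ≈ᴾ (p′ ∙ q′)
  ∙-cong {g₁ , f₁} {g₁′ , f₁′} {g₂ , f₂} {g₂′ , f₂′} (g₁≐ , f₁≐) (g₂≐ , f₂≐) =
      ⋆-cong g₁≐ (≐-trans (∘ₛ-congˡ f₁ g₂≐) (∘ₛ-congʳ g₂′ f₁≐))
    , ≐-trans (∘ₛ-congˡ f₁ f₂≐) (∘ₛ-congʳ f₂′ f₁≐)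

  ∙-assoc : ∀ p q r → ConstantFreeᴾ p → ConstantFreeᴾ q → ((p ∙ q) ∙ r) ≈ᴾ (p ∙ (q ∙ r))
  ∙-assoc (g₁ , f₁) (g₂ , f₂) (g₃ , f₃) f₁₀ f₂₀ =
      ≐-trans (⋆-assoc g₁ (g₂ ∘ₛ f₁) (g₃ ∘ₛ (f₂ ∘ₛ f₁)))
              (⋆-congʳ g₁ (≐-sym (≐-trans (⋆-∘ₛ f₁₀ g₂ (g₃ ∘ₛ f₂))
                                          (⋆-congʳ (g₂ ∘ₛ f₁) (∘ₛ-assoc f₂₀ f₁₀ g₃)))))
    , ≐-sym (∘ₛ-assoc f₂₀ f₁₀ f₃)

  ε-∙ : ∀ p → (ε ∙ p) ≈ᴾ p
  ε-∙ (g , f) = ≐-trans (one-⋆ (g ∘ₛ zS)) (∘ₛ-zS g) , ∘ₛ-zS f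

  ∙-ε : ∀ p → ConstantFreeᴾ p → (p ∙ ε) ≈ᴾ p
  ∙-ε (g , f) f₀ = ≐-trans (⋆-congʳ g (one-∘ₛ f₀)) (⋆-one g) , zS-∘ₛ f₀

  ∙-inverseʳ : ∀ p q r → ConstantFreeᴾ q → ConstantFreeᴾ r → (q ∙ p) ≈ᴾ ε → (r ∙ q) ≈ᴾ ε → (p ∙ q) ≈ᴾ ε
  ∙-inverseʳ p q r q₀ r₀ q∙p≈ε r∙q≈ε = begin
    p ∙ q              ≈⟨ ∙-cong p≈r ≈ᴾ-refl ⟩
    r ∙ q              ≈⟨ r∙q≈ε ⟩
    ε                  ∎
    where
    open SetoidR pairSetoid
    open Setoid pairSetoid using () renaming (refl to ≈ᴾ-refl; sym to ≈ᴾ-sym)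
    p≈r : p ≈ᴾ r
    p≈r = begin
      p              ≈⟨ ≈ᴾ-sym (ε-∙ p) ⟩
      ε ∙ p          ≈⟨ ∙-cong (≈ᴾ-sym r∙q≈ε) ≈ᴾ-refl ⟩
      (r ∙ q) ∙ p    ≈⟨ ∙-assoc r q p r₀ q₀ ⟩
      r ∙ (q ∙ p)    ≈⟨ ∙-cong ≈ᴾ-refl q∙p≈ε ⟩
      r ∙ ε          ≈⟨ ∙-ε r r₀ ⟩
      r              ∎

  sArrayᴾ : RiordanPair → Matrix
  sArrayᴾ (g , f) = sArray g f

  sArrayᴾ-⊗ : ∀ {A B} p q → ConstantFreeᴾ p → ConstantFreeᴾ q →
    A ≋ sArrayᴾ p → B ≋ sArrayᴾ q → (A ⊗ B) ≋ sArrayᴾ (p ∙ q)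
  sArrayᴾ-⊗ (g₁ , f₁) (g₂ , f₂) f₁₀ f₂₀ A≋ B≋ =
    doubles-unique
      (doubles-respʳ (riordan-⊗ g₁ g₂ f₂ f₁₀)
        (doubles-⊗ (doubles-respˡ A≋ (doubles-sArray g₁ f₁₀)) (doubles-respˡ B≋ (doubles-sArray g₂ f₂₀))))
      (doubles-sArray (g₁ ⋆ (g₂ ∘ₛ f₁)) (constantFree-∘ₛ f₁ f₂₀))

  sArrayᴾ-cong : ∀ {p q} → ConstantFreeᴾ p → ConstantFreeᴾ q → p ≈ᴾ q → sArrayᴾ p ≋ sArrayᴾ q
  sArrayᴾ-cong {g , f} {g′ , f′} f₀ f′₀ (g≐ , f≐) =
    doubles-unique (doubles-respʳ (riordan-cong g≐ f≐) (doubles-sArray g f₀)) (doubles-sArray g′ f′₀)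

  sArrayᴾ-ε : sArrayᴾ ε ≋ Id
  sArrayᴾ-ε = doubles-unique (doubles-respʳ riordan-one-zS (doubles-sArray one constantFree-zS)) doubles-Id

module Subgroup {c ℓ} (K : CommutativeRing c ℓ) (isField : IsField K) where
  open CommutativeRing K hiding (zero)
  open DR K
  open PowerSeries K
  open RiordanGroup K

  1≉0 : ¬ (1# ≈ 0#)
  1≉0 = proj₁ isField

  inverseOf : ∀ x → ¬ (x ≈ 0#) → Σ Carrier λ y → x * y ≈ 1#
  inverseOf = proj₂ isField

  invertible⇒≉0 : ∀ {a u} → a * u ≈ 1# → ¬ (u ≈ 0#)
  invertible⇒≉0 au≈1 u≈0 = 1≉0 (trans (sym au≈1) (trans (*-cong refl u≈0) (zeroʳ _)))

  *-≉0 : ∀ {a b} → ¬ (a ≈ 0#) → ¬ (b ≈ 0#) → ¬ (a * b ≈ 0#)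
  *-≉0 {a} {b} a≉0 b≉0 ab≈0 with inverseOf a a≉0
  ... | a⁻¹ , aa⁻¹≈1 = b≉0 (begin
    b                ≈⟨ sym (*-identityˡ b) ⟩
    1# * b           ≈⟨ *-cong (sym aa⁻¹≈1) refl ⟩
    (a * a⁻¹) * b    ≈⟨ xy∙z≈y∙xz a a⁻¹ b ⟩
    a⁻¹ * (a * b)    ≈⟨ *-cong refl ab≈0 ⟩
    a⁻¹ * 0#         ≈⟨ zeroʳ _ ⟩
    0#               ∎)
    where
    open SetoidR setoid
    open import Algebra.Properties.CommutativeSemigroup *-commutativeSemigroup using (xy∙z≈y∙xz)

  Proper : RiordanPair → Set ℓ
  Proper (g , f) = InF₀ g × InF₁ f

  proper⇒constantFree : ∀ p → Proper p → ConstantFreeᴾ p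
  proper⇒constantFree _ (_ , f₀≈0 , _) = constantFree f₀≈0

  ε-proper : Proper ε
  ε-proper = 1≉0 , refl , 1≉0

  ∙-proper : ∀ p q → Proper p → Proper q → Proper (p ∙ q)
  ∙-proper (g₁ , f₁) (g₂ , f₂) (g₁≉0 , f₁₀ , f₁₁) (g₂≉0 , f₂₀ , f₂₁) =
      (λ eq → *-≉0 g₁≉0 g₂≉0 (trans (*-cong refl (sym (∘ₛ-coeff₀ g₂ f₁))) eq))
    , trans (∘ₛ-coeff₀ f₂ f₁) f₂₀
    , (λ eq → *-≉0 f₂₁ f₁₁ (trans (sym (∘ₛ-coeff₁ {f₁} (constantFree f₁₀) f₂)) eq))

  leftInverse : ∀ p → Proper p → Σ RiordanPair λ q → Proper q × (q ∙ p) ≈ᴾ ε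
  leftInverse (g , f) (g₀≉0 , f₀≈0 , f₁≉0) with inverseOf (f 1) f₁≉0 | inverseOf (g 0) g₀≉0
  ... | u , f₁u≈1 | v , g₀v≈1 =
      (ĝ , f̂)
    , (invertible⇒≉0 {g 0} {v} g₀v≈1 , constant≈0 , λ f̂₁≈0 → invertible⇒≉0 f₁u≈1 (trans (sym f̂-coeff₁) f̂₁≈0))
    , ≐-trans (⋆-comm ĝ (g ∘ₛ f̂)) (⋆-reciprocal v (g ∘ₛ f̂) (trans (*-cong (∘ₛ-coeff₀ g f̂) refl) g₀v≈1))
    , ∘ₛ-f̂ (constantFree f₀≈0) f₁u≈1
    where
    open CompositionalInverse f u
    open ConstantFree constantFree-f̂
    ĝ = reciprocal v (g ∘ₛ f̂)

  inverse : ∀ p → Proper p → Σ RiordanPair λ q → Proper q × (p ∙ q) ≈ᴾ ε × (q ∙ p) ≈ᴾ ε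
  inverse p proper-p =
    let q , proper-q , q∙p≈ε = leftInverse p proper-p
        r , proper-r , r∙q≈ε = leftInverse q proper-q
    in q , proper-q , ∙-inverseʳ p q r (cf q proper-q) (cf r proper-r) q∙p≈ε r∙q≈ε , q∙p≈ε
    where cf = proper⇒constantFree

  inS : ∀ p → Proper p → ∀ {M} → M ≋ sArrayᴾ p → InS M
  inS (g , f) (g₀≉0 , f-F₁) M≋ = g , f , g₀≉0 , f-F₁ , M≋

  inS⇒inDR : ∀ M → InS M → InDR M
  inS⇒inDR M (g , f , g₀≉0 , (_ , f₁≉0) , M≋) =
    sub-z² g , zS , div-z (sub-z² f) , sub-z²-odd g , g₀≉0 , zS-odd , (refl , 1≉0) , sub-z²-odd f , (refl , f₁≉0) , M≋
    where
    zS-odd : IsOdd zS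
    zS-odd zero = refl
    zS-odd (suc n) rewrite +-suc n n = refl

  inS-Id : InS Id
  inS-Id = inS ε ε-proper (λ n k → sym (sArrayᴾ-ε n k))

  inS-⊗ : ∀ A B → InS A → InS B → InS (A ⊗ B)
  inS-⊗ A B (g₁ , f₁ , g₁≉0 , f₁-F₁ , A≋) (g₂ , f₂ , g₂≉0 , f₂-F₁ , B≋) =
    inS (p ∙ q) (∙-proper p q proper-p proper-q)
        (sArrayᴾ-⊗ p q (proper⇒constantFree p proper-p) (proper⇒constantFree q proper-q) A≋ B≋)
    where
    p = g₁ , f₁
    q = g₂ , f₂
    proper-p : Proper p
    proper-p = g₁≉0 , f₁-F₁
    proper-q : Proper q
    proper-q = g₂≉0 , f₂-F₁

  ⊗-≋-Id : ∀ {A B} p q → Proper p → Proper q → A ≋ sArrayᴾ p → B ≋ sArrayᴾ q → (p ∙ q) ≈ᴾ ε → (A ⊗ B) ≋ Id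
  ⊗-≋-Id p q proper-p proper-q A≋ B≋ p∙q≈ε n k =
    trans (sArrayᴾ-⊗ p q (cf p proper-p) (cf q proper-q) A≋ B≋ n k)
          (trans (sArrayᴾ-cong (cf (p ∙ q) (∙-proper p q proper-p proper-q)) constantFree-zS p∙q≈ε n k) (sArrayᴾ-ε n k))
    where cf = proper⇒constantFree

  inS-inverse : ∀ A → InS A → ∃[ B ] (InS B × (A ⊗ B) ≋ Id × (B ⊗ A) ≋ Id)
  inS-inverse A (g , f , g₀≉0 , f-F₁ , A≋) =
    let q , proper-q , p∙q≈ε , q∙p≈ε = inverse p proper-p
        B = sArrayᴾ q
    in  B
      , inS q proper-q {B} (λ _ _ → refl)
      , ⊗-≋-Id {A} {B} p q proper-p proper-q A≋ (λ _ _ → refl) p∙q≈ε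
      , ⊗-≋-Id {B} {A} q p proper-q proper-p (λ _ _ → refl) A≋ q∙p≈ε
    where
    p = g , f
    proper-p : Proper p
    proper-p = g₀≉0 , f-F₁

lemma2p1 : ∀ {c ℓ} (K : CommutativeRing c ℓ) → IsField K → DR.IsSubgroupDR K (DR.InS K)
lemma2p1 K isField = inS⇒inDR , inS-Id , inS-⊗ , inS-inverse
  where open Subgroup K isField
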